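{- Let $P=(v_0,\dots,v_\ell)$ be a path, $s=v_0$, and $t\in V(P)$. Then the two-rooted graph $(P,s,t)$ is not inherent if one of the following holds: (i) $\ell\ge 1$ and $t=v_0$; (ii) $\ell\ge 3$ and $t=v_{\ell-1}$; (iii) $\ell=3$ and $t=v_1$; (iv) $\ell=4$ and $t=v_1$; (v) $\ell=5$ and $t=v_2$.
   Context: All graphs are finite, simple and undirected. A two-rooted graph is a triple $(H,s,t)$ where $H$ is a graph and $s,t\in V(H)$ are not necessarily distinct. A copy of a two-rooted graph $(\hat H,\hat s,\hat t)$ in a graph $G$ is a two-rooted graph $(H,s,t)$ such that $H$ is an induced subgraph of $G$ and some isomorphism $\hat H\to H$ maps $\hat s\mapsto s$, $\hat t\mapsto t$. An extension of a copy $(H,s,t)$ in $G$ is a two-rooted graph $(H',s',t')$ with $H'$ an induced subgraph of $G$, $V(H')=V(H)\cup\{s',t'\}$, $s'\neq t'$, $s',t'\notin V(H)$, $H'-\{s',t'\}=H$, and $s$ (resp. $t$) the unique neighbour of $s'$ (resp. $t'$) in $H'$. The extension is closable if there is an induced $s',t'$-path in $G$ all of whose internal vertices lie outside $N_G[V(H)]$. A copy is avoidable if all its extensions in $G$ are closable. $(\hat H,\hat s,\hat t)$ is inherent if every graph $G$ containing an induced subgraph isomorphic to $\hat H$ also contains an avoidable copy of $(\hat H,\hat s,\hat t)$. -}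

module Defs where

open import Data.Nat using (ℕ; zero; suc; _≤_; _<_; _∸_)
open import Data.Nat.Base using (_≡ᵇ_)
open import Data.Bool using (Bool; true; false; _∨_)
open import Data.Bool.Properties using (∨-comm)
open import Data.Fin using (Fin; toℕ; fromℕ) renaming (zero to zeroF)
open import Data.Product using (Σ; _×_; ∃; _,_)
open import Data.Sum using (_⊎_)
open import Relation.Nullary using (¬_)
open import Relation.Binary.PropositionalEquality using (_≡_; _≢_; refl)
open import Function.Definitions using (Injective)

record Graph : Set where
  field
    n         : ℕ
    adj       : Fin n → Fin n → Bool
    adj-sym   : ∀ u v → adj u v ≡ adj v u
    adj-irref : ∀ u → adj u u ≡ false
open Graph public

Adj : (G : Graph) → Fin (n G) → Fin (n G) → Set
Adj G u v = adj G u v ≡ true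

record Embedding (H G : Graph) : Set where
  field
    map     : Fin (n H) → Fin (n G)
    inj     : Injective _≡_ _≡_ map
    induced : ∀ i j → adj G (map i) (map j) ≡ adj H i j
open Embedding public

private
  suc≢ : ∀ a → (suc a ≡ᵇ a) ≡ false
  suc≢ zero    = refl
  suc≢ (suc a) = suc≢ a

pathAdj : ∀ ℓ → Fin (suc ℓ) → Fin (suc ℓ) → Bool
pathAdj ℓ i j = (suc (toℕ i) ≡ᵇ toℕ j) ∨ (suc (toℕ j) ≡ᵇ toℕ i)

Path : ℕ → Graph
Path ℓ = record
  { n = suc ℓ
  ; adj = pathAdj ℓ
  ; adj-sym = λ i j → ∨-comm (suc (toℕ i) ≡ᵇ toℕ j) (suc (toℕ j) ≡ᵇ toℕ i)
  ; adj-irref = λ i → irr (toℕ i)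
  }
  where
  irr : ∀ a → ((suc a ≡ᵇ a) ∨ (suc a ≡ᵇ a)) ≡ false
  irr a rewrite suc≢ a = refl

InClosedNbhd : ∀ {H G} → Embedding H G → Fin (n G) → Set
InClosedNbhd {H} {G} f x = Σ (Fin (n H)) λ i → (x ≡ map f i) ⊎ Adj G x (map f i)

-- An extension (H', s', t') of the copy (f(H), f(s), f(t)): s' ≠ t' outside V(H),
-- f(s) the unique neighbour of s' in H' = G[V(H) ∪ {s',t'}], likewise for t'.
record Extension {H G : Graph} (f : Embedding H G) (s t : Fin (n H)) : Set where
  field
    s' t'     : Fin (n G)
    s'≢t'     : s' ≢ t'
    s'∉H      : ∀ i → s' ≢ map f i
    t'∉H      : ∀ i → t' ≢ map f i
    s'~s      : Adj G s' (map f s)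
    t'~t      : Adj G t' (map f t)
    s'-only-s : ∀ i → Adj G s' (map f i) → i ≡ s
    t'-only-t : ∀ i → Adj G t' (map f i) → i ≡ t
    s'≁t'     : ¬ Adj G s' t'
open Extension public

record ClosingPath {H G : Graph} (f : Embedding H G) (x y : Fin (n G)) : Set where
  field
    len      : ℕ
    path     : Embedding (Path len) G
    start    : map path zeroF ≡ x
    end      : map path (fromℕ len) ≡ y
    internal : ∀ (i : Fin (suc len)) → 0 < toℕ i → toℕ i < len
               → ¬ InClosedNbhd f (map path i)
  
Closable : ∀ {H G} {f : Embedding H G} {s t} → Extension f s t → Set
Closable {f = f} e = ClosingPath f (s' e) (t' e)

Avoidable : ∀ {H G} → Embedding H G → Fin (n H) → Fin (n H) → Set
Avoidable f s t = ∀ (e : Extension f s t) → Closable e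

Inherent : (H : Graph) → Fin (n H) → Fin (n H) → Set
Inherent H s t = ∀ (G : Graph) → Embedding H G
               → Σ (Embedding H G) λ f → Avoidable f s t

Condition : ∀ ℓ → Fin (suc ℓ) → Set
Condition ℓ t =
     (1 ≤ ℓ × toℕ t ≡ 0)
  ⊎ (3 ≤ ℓ × toℕ t ≡ ℓ ∸ 1)
  ⊎ (ℓ ≡ 3 × toℕ t ≡ 1)
  ⊎ (ℓ ≡ 4 × toℕ t ≡ 1)
  ⊎ (ℓ ≡ 5 × toℕ t ≡ 2)

-- Each case is refuted by one graph G containing P in which every copy of (P, s, t) has an
-- extension that cannot be closed.
--
-- For (i) with ℓ ≠ 2 and for (ii), G is the cycle C_{ℓ+3} with every vertex doubled into two
-- non-adjacent twins. An induced path on ℓ + 1 vertices never turns back (else v_k and v_{k+2}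
-- would be twins), so up to a symmetry of the cycle it occupies positions 0, …, ℓ. It then
-- dominates G, so no extension with non-adjacent s', t' closes; the two vertices at position
-- ℓ + 2 (for (i)), or one of them and the twin of v_ℓ (for (ii)), give such an extension.
--
-- For (i) with ℓ = 2 and (iii) G is the Petersen graph, for (iv) and (v) the Heawood graph,
-- checked by exhaustive search: for every copy an extension is found such that s' and its
-- neighbours outside N[V(H)] form a set closed under steps outside N[V(H)] and not adjacent
-- to t', which traps every candidate closing path.
module Submission where

open import Defs
open import Data.Bool using (Bool; true; false; T; if_then_else_; _∧_; _∨_)
import Data.Bool.Properties as Bool
open import Data.Fin using (Fin; toℕ; fromℕ; fromℕ<; splitAt; join; #_)
  renaming (zero to zeroF; suc to sucF)
open import Data.Fin.Properties
  using (_≟_; all?; any?; toℕ<n; toℕ-fromℕ<; toℕ-fromℕ; toℕ-injective; splitAt-join)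
import Data.Fin.Properties as Fin
open import Data.Nat using (ℕ; zero; suc; _+_; _∸_; _%_; _≤_; _<_; _≡ᵇ_; _<ᵇ_; _≤ᵇ_; z≤n; s≤s; z<s; pred; _<?_)
open import Data.Nat.Properties hiding (_≟_)
import Data.Nat.Properties as ℕ
open import Data.Product using (Σ; Σ-syntax; ∃; _×_; _,_; proj₁; proj₂)
open import Data.Sum using (_⊎_; inj₁; inj₂; [_,_]′; swap)
import Data.Sum as Sum
open import Data.Unit using (⊤; tt)
open import Data.Vec using (Vec; []; _∷_; lookup; tabulate)
open import Data.Vec.Properties using (lookup∘tabulate)
open import Data.Vec.Relation.Unary.All as All using (All)
open import Data.Vec.Relation.Unary.All.Properties using (tabulate⁺)
open import Function using (_∘_; mk⇔; Equivalence)
open import Function.Definitions using (Injective)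
open import Relation.Binary.Definitions using (tri<; tri≈; tri>)
open import Relation.Binary.PropositionalEquality
open import Relation.Nullary using (¬_; Dec; yes; no; contradiction)
open import Relation.Nullary.Decidable
  using (map′; _×-dec_; _⊎-dec_; _→-dec_; ¬?; True; toWitness; dec-true; dec-false; does-⇔)

true≢false : true ≢ false
true≢false ()

-- Reading a copy of a path through natural-number indices; an index beyond ℓ
-- is sent to v₀, so statements about `vertex k` carry the hypothesis k ≤ ℓ.
module PathCopy {G : Graph} {ℓ : ℕ} (f : Embedding (Path ℓ) G) where

  index : ℕ → Fin (suc ℓ)
  index k with k <? suc ℓ
  ... | yes k<1+ℓ = fromℕ< k<1+ℓ
  ... | no _      = zeroF

  toℕ-index : ∀ {k} → k ≤ ℓ → toℕ (index k) ≡ k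
  toℕ-index {k} k≤ℓ with k <? suc ℓ
  ... | yes k<1+ℓ = toℕ-fromℕ< k<1+ℓ
  ... | no k≮1+ℓ  = contradiction (s≤s k≤ℓ) k≮1+ℓ

  index-toℕ : ∀ i → index (toℕ i) ≡ i
  index-toℕ i = toℕ-injective (toℕ-index (≤-pred (toℕ<n i)))

  vertex : ℕ → Fin (n G)
  vertex k = map f (index k)

  map≡vertex : ∀ i → map f i ≡ vertex (toℕ i)
  map≡vertex i = cong (map f) (sym (index-toℕ i))

  vertex-last : vertex ℓ ≡ map f (fromℕ ℓ)
  vertex-last = cong (map f) (toℕ-injective (trans (toℕ-index ≤-refl) (sym (toℕ-fromℕ ℓ))))

  vertex-adj : ∀ {j k} → j ≤ ℓ → k ≤ ℓ → adj G (vertex j) (vertex k) ≡ ((suc j ≡ᵇ k) ∨ (suc k ≡ᵇ j))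
  vertex-adj {j} {k} j≤ℓ k≤ℓ = trans (induced f (index j) (index k))
    (cong₂ (λ a b → (suc a ≡ᵇ b) ∨ (suc b ≡ᵇ a)) (toℕ-index j≤ℓ) (toℕ-index k≤ℓ))

  vertex-step : ∀ {k} → suc k ≤ ℓ → Adj G (vertex k) (vertex (suc k))
  vertex-step {k} k<ℓ =
    trans (vertex-adj (<⇒≤ k<ℓ) k<ℓ) (cong (_∨ (suc (suc k) ≡ᵇ k)) (dec-true (suc k ℕ.≟ suc k) refl))

  vertex-far : ∀ {j k} → suc (suc j) ≤ k → k ≤ ℓ → adj G (vertex j) (vertex k) ≡ false
  vertex-far {j} {k} j+2≤k k≤ℓ = trans (vertex-adj (≤-trans (m≤n+m j 2) (≤-trans j+2≤k k≤ℓ)) k≤ℓ)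
    (cong₂ _∨_ (dec-false (suc j ℕ.≟ k) λ { refl → <-irrefl refl j+2≤k })
               (dec-false (suc k ℕ.≟ j) λ { refl → <-irrefl refl (≤-trans (m≤n+m (suc k) 2) j+2≤k) }))

  -- v_j and v_{j+2} are told apart by v_{j-1}, or by v_3 when j = 0.
  not-twins : ∀ {j} → suc (suc j) ≤ ℓ → ℓ ≢ 2 → ¬ (∀ w → adj G (vertex (suc (suc j))) w ≡ adj G (vertex j) w)
  not-twins {zero}  2≤ℓ ℓ≢2 same =
    true≢false (trans (sym (vertex-step 3≤ℓ)) (trans (same (vertex 3)) (vertex-far (n≤1+n 2) 3≤ℓ)))
    where 3≤ℓ = ≤∧≢⇒< 2≤ℓ (ℓ≢2 ∘ sym)
  not-twins {suc j} j+3≤ℓ _ same = true≢false (begin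
    true                             ≡⟨ sym (vertex-step (≤-trans (n≤1+n _) (≤-trans (n≤1+n _) j+3≤ℓ))) ⟩
    adj G (vertex j) (vertex (suc j)) ≡⟨ adj-sym G _ _ ⟩
    adj G (vertex (suc j)) (vertex j) ≡⟨ sym (same (vertex j)) ⟩
    adj G (vertex (3 + j)) (vertex j) ≡⟨ adj-sym G _ _ ⟩
    adj G (vertex j) (vertex (3 + j)) ≡⟨ vertex-far (n≤1+n _) j+3≤ℓ ⟩
    false                            ∎)
    where open ≡-Reasoning

-- Every vertex of a closing path except t' lies in R.
module _ {H G : Graph} (f : Embedding H G) {s' t' : Fin (n G)} (R : Fin (n G) → Set)
         (s'∈R : R s') (s'≢t' : s' ≢ t')
         (R-closed : ∀ {u w} → R u → Adj G u w → ¬ InClosedNbhd f w → R w)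
         (R≁t' : ∀ {u} → R u → ¬ Adj G u t') where

  trap⇒¬closingPath : ¬ ClosingPath f s' t'
  trap⇒¬closingPath record { len = zero ; start = start ; end = end } = s'≢t' (trans (sym start) end)
  trap⇒¬closingPath record { len = suc m ; path = p ; start = start ; end = end ; internal = internal }
    = R≁t' (inside ≤-refl) (subst (Adj G (vertex m)) (trans vertex-last end) (vertex-step ≤-refl))
    where
    open PathCopy p
    inside : ∀ {k} → k < suc m → R (vertex k)
    inside {zero}  _     = subst R (sym start) s'∈R
    inside {suc k} k+1<L = R-closed (inside (<⇒≤ k+1<L)) (vertex-step (<⇒≤ k+1<L))
      (internal (index (suc k)) (subst (0 <_) (sym (toℕ-index (<⇒≤ k+1<L))) (s≤s z≤n))
                                (subst (_< suc m) (sym (toℕ-index (<⇒≤ k+1<L))) k+1<L))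

dominating⇒¬closingPath : ∀ {H G} (f : Embedding H G) {s' t'} → (∀ w → InClosedNbhd f w)
  → s' ≢ t' → ¬ Adj G s' t' → ¬ ClosingPath f s' t'
dominating⇒¬closingPath f {s'} dominating s'≢t' s'≁t' =
  trap⇒¬closingPath f (_≡ s') refl s'≢t' (λ _ _ w∉N → contradiction (dominating _) w∉N)
                                         λ { refl → s'≁t' }

module _ (G : Graph) {k : ℕ} (v : Fin k → Fin (n G)) where

  Near : Fin (n G) → Set
  Near w = ∃ λ i → (w ≡ v i) ⊎ Adj G w (v i)

  Pendant : Fin k → Fin (n G) → Set
  Pendant i w = Adj G w (v i) × (∀ j → w ≢ v j) × (∀ j → Adj G w (v j) → j ≡ i)

module _ (G : Graph) {k : ℕ} {v v′ : Fin k → Fin (n G)} (v≗v′ : v ≗ v′) where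

  Near-resp : ∀ {w} → Near G v w → Near G v′ w
  Near-resp (i , inj₁ w≡vi) = i , inj₁ (trans w≡vi (v≗v′ i))
  Near-resp (i , inj₂ w~vi) = i , inj₂ (subst (Adj G _) (v≗v′ i) w~vi)

  Pendant-resp : ∀ {i w} → Pendant G v i w → Pendant G v′ i w
  Pendant-resp (w~vi , w∉v , only) =
    subst (Adj G _) (v≗v′ _) w~vi ,
    (λ j w≡v′j → w∉v j (trans w≡v′j (sym (v≗v′ j)))) ,
    (λ j → only j ∘ subst (Adj G _) (sym (v≗v′ j)))

pendants⇒extension : ∀ {H G} (f : Embedding H G) {s t s' t'}
  → Pendant G (map f) s s' → Pendant G (map f) t t' → s' ≢ t' → ¬ Adj G s' t' → Extension f s t
pendants⇒extension f {s' = s'} {t'} (s'~s , s'∉H , s'-only) (t'~t , t'∉H , t'-only) s'≢t' s'≁t' = record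
  { s' = s' ; t' = t' ; s'≢t' = s'≢t' ; s'∉H = s'∉H ; t'∉H = t'∉H ; s'~s = s'~s ; t'~t = t'~t
  ; s'-only-s = s'-only ; t'-only-t = t'-only ; s'≁t' = s'≁t' }

UnclosableExtension : ∀ {H G} → Embedding H G → Fin (n H) → Fin (n H) → Set
UnclosableExtension f s t = Σ (Extension f s t) λ e → ¬ Closable e

unclosable⇒¬inherent : ∀ {H G s t} → Embedding H G → (∀ f → UnclosableExtension f s t) → ¬ Inherent H s t
unclosable⇒¬inherent seed unclosable inherent with inherent _ seed
... | f , avoidable with unclosable f
...   | e , ¬closable = ¬closable (avoidable e)

module Search (G : Graph) where

  private
    V = Fin (n G)

  adj? : ∀ u w → Dec (Adj G u w)
  adj? u w = adj G u w Bool.≟ true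

  Extends : ∀ {k} → V → Vec V (suc k) → Set
  Extends x (y ∷ ys) = Adj G x y × All (x ≢_) (y ∷ ys) × All (λ z → ¬ Adj G x z) ys

  extends? : ∀ {k} x (ys : Vec V (suc k)) → Dec (Extends x ys)
  extends? x (y ∷ ys) =
    adj? x y ×-dec All.all? (λ z → ¬? (x ≟ z)) (y ∷ ys) ×-dec All.all? (λ z → ¬? (adj? x z)) ys

  IsInducedPath : ∀ {k} → Vec V (suc k) → Set
  IsInducedPath (x ∷ [])     = ⊤
  IsInducedPath (x ∷ y ∷ ys) = Extends x (y ∷ ys) × IsInducedPath (y ∷ ys)

  all-inducedPaths? : ∀ k {P : Vec V (suc k) → Set} → (∀ xs → Dec (P xs)) → Dec (∀ xs → IsInducedPath xs → P xs)
  all-inducedPaths? zero    P? = map′ (λ h → λ { (x ∷ []) _ → h x }) (λ h x → h (x ∷ []) tt)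
                                     (all? λ x → P? (x ∷ []))
  all-inducedPaths? (suc k) P? = map′ (λ h → λ { (x ∷ y ∷ ys) (x⁺ , p) → h (y ∷ ys) p x x⁺ })
                                     (λ h → λ { (y ∷ ys) p x x⁺ → h (x ∷ y ∷ ys) (x⁺ , p) })
                                     (all-inducedPaths? k λ ys → all? λ x → extends? x ys →-dec P? (x ∷ ys))

  tabulate-inducedPath : ∀ {k} (g : Fin (suc k) → V) → Injective _≡_ _≡_ g
    → (∀ i j → adj G (g i) (g j) ≡ pathAdj k i j) → IsInducedPath (tabulate g)
  tabulate-inducedPath {zero}  g g-inj g-ind = tt
  tabulate-inducedPath {suc k} g g-inj g-ind =
    ( g-ind zeroF (sucF zeroF)
    , tabulate⁺ (λ i → Fin.0≢1+n {i = i} ∘ g-inj)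
    , tabulate⁺ (λ i g0~g2+i → true≢false (trans (sym g0~g2+i) (g-ind zeroF (sucF (sucF i))))) )
    , tabulate-inducedPath (g ∘ sucF) (Fin.suc-injective ∘ g-inj) (λ i j → g-ind (sucF i) (sucF j))

  module _ {k : ℕ} (v : Fin k → V) where

    near? : ∀ w → Dec (Near G v w)
    near? w = any? λ i → (w ≟ v i) ⊎-dec adj? w (v i)

    pendant? : ∀ i w → Dec (Pendant G v i w)
    pendant? i w =
      adj? w (v i) ×-dec all? (λ j → ¬? (w ≟ v j)) ×-dec all? (λ j → adj? w (v j) →-dec j ≟ i)

    -- For the Petersen and Heawood graphs, s' with its neighbours outside N[v] already closes up.
    Trap : V → V → Set
    Trap s' w = w ≡ s' ⊎ (Adj G s' w × ¬ Near G v w)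

    trap? : ∀ s' w → Dec (Trap s' w)
    trap? s' w = (w ≟ s') ⊎-dec (adj? s' w ×-dec ¬? (near? w))

    TrapClosed : V → V → Set
    TrapClosed s' t' = (∀ u → Trap s' u → ∀ w → Adj G u w → ¬ Near G v w → Trap s' w)
                     × (∀ u → Trap s' u → ¬ Adj G u t')

    trapClosed? : ∀ s' t' → Dec (TrapClosed s' t')
    trapClosed? s' t' = all? (λ u → trap? s' u →-dec all? λ w → adj? u w →-dec ¬? (near? w) →-dec trap? s' w)
                  ×-dec all? (λ u → trap? s' u →-dec ¬? (adj? u t'))

    TrappedExtension : Fin k → Fin k → Set
    TrappedExtension s t = Σ[ s' ∈ V ] Pendant G v s s' × Σ[ t' ∈ V ] Pendant G v t t'
                         × s' ≢ t' × ¬ Adj G s' t' × TrapClosed s' t'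

    trappedExtension? : ∀ s t → Dec (TrappedExtension s t)
    trappedExtension? s t = any? λ s' → pendant? s s' ×-dec any? λ t' → pendant? t t'
      ×-dec ¬? (s' ≟ t') ×-dec ¬? (adj? s' t') ×-dec trapClosed? s' t'

  AllCopiesTrapped : (ℓ : ℕ) → Fin (suc ℓ) → Set
  AllCopiesTrapped ℓ t = ∀ xs → IsInducedPath xs → TrappedExtension (lookup xs) zeroF t

  allCopiesTrapped? : ∀ ℓ t → Dec (AllCopiesTrapped ℓ t)
  allCopiesTrapped? ℓ t = all-inducedPaths? ℓ λ xs → trappedExtension? (lookup xs) zeroF t

  module _ {ℓ : ℕ} (f : Embedding (Path ℓ) G) where

    copy : Vec V (suc ℓ)
    copy = tabulate (map f)

    lookup-copy : lookup copy ≗ map f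
    lookup-copy = lookup∘tabulate (map f)

    trapped⇒unclosable : ∀ {t} → TrappedExtension (lookup copy) zeroF t → UnclosableExtension f zeroF t
    trapped⇒unclosable (s' , s'-pendant , t' , t'-pendant , s'≢t' , s'≁t' , trap-closed , trap≁t') =
      pendants⇒extension f (Pendant-resp G lookup-copy s'-pendant) (Pendant-resp G lookup-copy t'-pendant)
                           s'≢t' s'≁t' ,
      trap⇒¬closingPath f (Trap (lookup copy) s') (inj₁ refl) s'≢t'
        (λ {u} {w} u∈R u~w w∉N → trap-closed u u∈R w u~w (w∉N ∘ Near-resp G lookup-copy))
        (λ {u} → trap≁t' u)

  allCopiesTrapped⇒¬inherent : ∀ {ℓ t} → Embedding (Path ℓ) G → True (allCopiesTrapped? ℓ t)
                              → ¬ Inherent (Path ℓ) zeroF t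
  allCopiesTrapped⇒¬inherent seed trapped = unclosable⇒¬inherent seed λ f →
    trapped⇒unclosable f (toWitness trapped (copy f) (tabulate-inducedPath (map f) (inj f) (induced f)))

symmetricClosure : (m : ℕ) (r : Fin m → Fin m → Bool) → True (all? λ u → r u u Bool.≟ false) → Graph
symmetricClosure m r irreflexive = record
  { n = m
  ; adj = λ u v → r u v ∨ r v u
  ; adj-sym = λ u v → Bool.∨-comm (r u v) (r v u)
  ; adj-irref = λ u → cong (λ b → b ∨ b) (toWitness irreflexive u)
  }

-- The generalised Petersen graph GP(5,2): outer 5-cycle on 0..4, spokes i ~ i+5,
-- and the pentagram i+5 ~ (i+2 mod 5)+5 inside.
petersen : Graph
petersen = symmetricClosure 10 (λ u v → edge (toℕ u) (toℕ v)) _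
  where
  edge : ℕ → ℕ → Bool
  edge a b = ((a <ᵇ 5) ∧ ((b ≡ᵇ suc a % 5) ∨ (b ≡ᵇ a + 5)))
           ∨ ((5 ≤ᵇ a) ∧ (5 ≤ᵇ b) ∧ (b ∸ 5 ≡ᵇ (a ∸ 5 + 2) % 5))

-- The Heawood graph: incidence graph of the Fano plane on the points 0..6 and the lines 7..13,
-- the point p lying on the lines 7 + (p + d mod 7) for d = 0, 1, 3.
heawood : Graph
heawood = symmetricClosure 14 (λ u v → incident (toℕ u) (toℕ v)) _
  where
  incident : ℕ → ℕ → Bool
  incident p l = (p <ᵇ 7) ∧ (7 ≤ᵇ l) ∧ ((d ≡ᵇ 0) ∨ (d ≡ᵇ 1) ∨ (d ≡ᵇ 3))
    where d = (l ∸ p) % 7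

IsEmbedding : ∀ H G → (Fin (n H) → Fin (n G)) → Set
IsEmbedding H G φ = (∀ i j → φ i ≡ φ j → i ≡ j) × (∀ i j → adj G (φ i) (φ j) ≡ adj H i j)

isEmbedding? : ∀ {H G} φ → Dec (IsEmbedding H G φ)
isEmbedding? {H} {G} φ = all? (λ i → all? λ j → φ i ≟ φ j →-dec i ≟ j)
                   ×-dec all? (λ i → all? λ j → adj G (φ i) (φ j) Bool.≟ adj H i j)

embedding : ∀ {H G} φ → True (isEmbedding? {H} {G} φ) → Embedding H G
embedding φ isEmbedding = record
  { map     = φ
  ; inj     = λ {i} {j} → proj₁ (toWitness isEmbedding) i j
  ; induced = proj₂ (toWitness isEmbedding)
  }

-- The cycle ℤ/m with m = ℓ + 3, its elements represented by the naturals below m.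
module Cycle (ℓ : ℕ) where

  m top : ℕ
  m   = 3 + ℓ
  top = 2 + ℓ

  next : ℕ → ℕ
  next p = if p ≡ᵇ top then 0 else suc p

  prev : ℕ → ℕ
  prev zero    = top
  prev (suc p) = p

  reflect : ℕ → ℕ
  reflect zero    = zero
  reflect (suc p) = m ∸ suc p

  next-cases : ∀ p → (p ≡ top × next p ≡ 0) ⊎ (p ≢ top × next p ≡ suc p)
  next-cases p with p ≡ᵇ top in eq
  ... | true  = inj₁ (≡ᵇ⇒≡ p top (subst T (sym eq) _) , refl)
  ... | false = inj₂ ((λ p≡top → subst T eq (≡⇒≡ᵇ p top p≡top)) , refl)

  next-top : next top ≡ 0
  next-top with next-cases top
  ... | inj₁ (_ , e)      = e
  ... | inj₂ (top≢top , _) = contradiction refl top≢top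

  next-below : ∀ {p} → p < top → next p ≡ suc p
  next-below {p} p<top with next-cases p
  ... | inj₁ (refl , _) = contradiction p<top (<-irrefl refl)
  ... | inj₂ (_ , e)    = e

  next-< : ∀ {p} → p < m → next p < m
  next-< {p} p<m with next-cases p
  ... | inj₁ (_ , e)      = subst (_< m) (sym e) z<s
  ... | inj₂ (p≢top , e) = subst (_< m) (sym e) (s≤s (≤∧≢⇒< (≤-pred p<m) p≢top))

  next≡suc⇒ : ∀ {p q} → next p ≡ suc q → p ≡ q
  next≡suc⇒ {p} e with next-cases p
  ... | inj₁ (_ , e′) = contradiction (trans (sym e′) e) (0≢1+n)
  ... | inj₂ (_ , e′) = suc-injective (trans (sym e′) e)

  next≡0⇒ : ∀ {p} → next p ≡ 0 → p ≡ top
  next≡0⇒ {p} e with next-cases p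
  ... | inj₁ (p≡top , _) = p≡top
  ... | inj₂ (_ , e′)    = contradiction (trans (sym e′) e) 1+n≢0

  prev-< : ∀ {p} → p < m → prev p < m
  prev-< {zero}  _   = ≤-refl
  prev-< {suc p} p<m = <-trans (n<1+n p) p<m

  prev-next : ∀ {p} → p < m → prev (next p) ≡ p
  prev-next {p} p<m with next-cases p
  ... | inj₁ (p≡top , e) rewrite e = sym p≡top
  ... | inj₂ (_ , e)     rewrite e = refl

  next-prev : ∀ {p} → p < m → next (prev p) ≡ p
  next-prev {zero}  _   = next-top
  next-prev {suc p} p<m = next-below (≤-pred p<m)

  reflect-< : ∀ {p} → p < m → reflect p < m
  reflect-< {zero}  _   = z<s
  reflect-< {suc p} p<m = ∸-monoʳ-< z<s (<⇒≤ p<m)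

  reflect-involutive : ∀ {p} → p < m → reflect (reflect p) ≡ p
  reflect-involutive {zero}  _   = refl
  reflect-involutive {suc p} p<m with m ∸ suc p in eq
  ... | zero  = contradiction eq (m>n⇒m∸n≢0 p<m)
  ... | suc k = trans (cong (m ∸_) (sym eq)) (m∸[m∸n]≡n (<⇒≤ p<m))

  reflect-top : reflect top ≡ 1
  reflect-top = m+n∸n≡m 1 ℓ

  reflect-next : ∀ {p} → p < m → reflect (next p) ≡ prev (reflect p)
  reflect-next {p} p<m with next-cases p
  ... | inj₁ (refl , e) rewrite e | reflect-top = refl
  ... | inj₂ (_ , e) rewrite e with p
  ...   | zero  = refl
  ...   | suc q with m ∸ suc q in eq
  ...     | zero  = contradiction eq (m>n⇒m∸n≢0 p<m)
  ...     | suc k = trans (sym (pred[m∸n]≡m∸[1+n] m (suc q))) (cong pred eq)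

  cycleAdj : ℕ → ℕ → Bool
  cycleAdj p q = (next p ≡ᵇ q) ∨ (next q ≡ᵇ p)

  cycleAdj⇒next : ∀ {p q} → cycleAdj p q ≡ true → q ≡ next p ⊎ p ≡ next q
  cycleAdj⇒next {p} {q} a with Equivalence.to Bool.T-∨ (Equivalence.from Bool.T-≡ a)
  ... | inj₁ e = inj₁ (sym (≡ᵇ⇒≡ (next p) q e))
  ... | inj₂ e = inj₂ (sym (≡ᵇ⇒≡ (next q) p e))

  next⇒cycleAdj : ∀ {p q} → q ≡ next p ⊎ p ≡ next q → cycleAdj p q ≡ true
  next⇒cycleAdj {p} {q} e = Equivalence.to Bool.T-≡ (Equivalence.from Bool.T-∨ (Sum.map
    (λ q≡next-p → ≡⇒≡ᵇ (next p) q (sym q≡next-p))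
    (λ p≡next-q → ≡⇒≡ᵇ (next q) p (sym p≡next-q)) e))

  cycleAdj-irrefl : ∀ p → cycleAdj p p ≡ false
  cycleAdj-irrefl p = trans (Bool.∨-idem (next p ≡ᵇ p)) (dec-false (next p ℕ.≟ p) next≢self)
    where
    next≢self : next p ≢ p
    next≢self with next-cases p
    ... | inj₁ (refl , e) = λ 0≡top → 0≢1+n (trans (sym e) 0≡top)
    ... | inj₂ (_ , e)    = 1+n≢n ∘ trans (sym e)

  cycleAdj-prev : ∀ {p q} → p < m → q < m → cycleAdj (prev p) (prev q) ≡ cycleAdj p q
  cycleAdj-prev p<m q<m = cong₂ _∨_ (next-prev-≡ᵇ p<m q<m) (next-prev-≡ᵇ q<m p<m)
    where
    next-prev-≡ᵇ : ∀ {p q} → p < m → q < m → (next (prev p) ≡ᵇ prev q) ≡ (next p ≡ᵇ q)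
    next-prev-≡ᵇ {p} {q} p<m q<m rewrite next-prev p<m = does-⇔
      (mk⇔ (λ p≡prev-q → trans (cong next p≡prev-q) (next-prev q<m))
           (λ next-p≡q → trans (sym (prev-next p<m)) (cong prev next-p≡q)))
      (p ℕ.≟ prev q) (next p ℕ.≟ q)

  cycleAdj-reflect : ∀ {p q} → p < m → q < m → cycleAdj (reflect p) (reflect q) ≡ cycleAdj p q
  cycleAdj-reflect {p} {q} p<m q<m =
    trans (cong₂ _∨_ (next-reflect-≡ᵇ p<m q<m) (next-reflect-≡ᵇ q<m p<m))
          (Bool.∨-comm (next q ≡ᵇ p) (next p ≡ᵇ q))
    where
    next-reflect-≡ᵇ : ∀ {p q} → p < m → q < m → (next (reflect p) ≡ᵇ reflect q) ≡ (next q ≡ᵇ p)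
    next-reflect-≡ᵇ {p} {q} p<m q<m = does-⇔ (mk⇔ to from) (next (reflect p) ℕ.≟ reflect q) (next q ℕ.≟ p)
      where
      to : next (reflect p) ≡ reflect q → next q ≡ p
      to e = begin
        next q                   ≡⟨ sym (reflect-involutive (next-< q<m)) ⟩
        reflect (reflect (next q)) ≡⟨ cong reflect (reflect-next q<m) ⟩
        reflect (prev (reflect q)) ≡⟨ cong (reflect ∘ prev) (sym e) ⟩
        reflect (prev (next (reflect p))) ≡⟨ cong reflect (prev-next (reflect-< p<m)) ⟩
        reflect (reflect p)      ≡⟨ reflect-involutive p<m ⟩
        p                        ∎
        where open ≡-Reasoning
      from : next q ≡ p → next (reflect p) ≡ reflect q
      from refl = trans (cong next (reflect-next q<m)) (next-prev (reflect-< q<m))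

  cycleAdj-top-0 : cycleAdj top 0 ≡ true
  cycleAdj-top-0 = next⇒cycleAdj (inj₁ (sym next-top))

  cycleAdj-top⇒0 : ∀ {q} → q ≤ ℓ → cycleAdj top q ≡ true → q ≡ 0
  cycleAdj-top⇒0 {q} q≤ℓ a with cycleAdj⇒next a
  ... | inj₁ q≡0   = trans q≡0 next-top
  ... | inj₂ top≡q+1 = contradiction (trans top≡q+1 (next-below (s≤s (≤-trans q≤ℓ (n≤1+n ℓ)))))
                                     (λ e → <-irrefl (sym (suc-injective e)) (s≤s q≤ℓ))

  cycleAdj-last : 1 ≤ ℓ → cycleAdj ℓ (ℓ ∸ 1) ≡ true
  cycleAdj-last 1≤ℓ =
    next⇒cycleAdj (inj₂ (sym (trans (next-below (s≤s (≤-trans (m∸n≤m ℓ 1) (n≤1+n ℓ)))) (m+[n∸m]≡n 1≤ℓ))))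

  cycleAdj-last⇒ : ∀ {q} → q ≤ ℓ → cycleAdj ℓ q ≡ true → q ≡ ℓ ∸ 1
  cycleAdj-last⇒ {q} q≤ℓ a with cycleAdj⇒next a
  ... | inj₁ q≡ℓ+1 = contradiction (trans q≡ℓ+1 (next-below (s≤s (n≤1+n ℓ)))) (λ e → <-irrefl e (s≤s q≤ℓ))
  ... | inj₂ ℓ≡q+1 = cong pred (trans (sym (next-below (s≤s (≤-trans q≤ℓ (n≤1+n ℓ))))) (sym ℓ≡q+1))

  cycle-dominated : 1 ≤ ℓ → ∀ {d} → d < m → Σ ℕ λ j → j ≤ ℓ × cycleAdj d j ≡ true
  cycle-dominated 1≤ℓ {d} d<m with <-cmp d ℓ
  ... | tri< d<ℓ _ _  = suc d , d<ℓ , next⇒cycleAdj (inj₁ (sym (next-below (≤-trans d<ℓ (m≤n+m ℓ 2)))))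
  ... | tri≈ _ refl _ = ℓ ∸ 1 , m∸n≤m ℓ 1 , cycleAdj-last 1≤ℓ
  ... | tri> _ _ ℓ<d with d ℕ.≟ top
  ...   | yes refl    = 0 , z≤n , cycleAdj-top-0
  ...   | no d≢top    = ℓ , ≤-refl , next⇒cycleAdj (inj₂ (trans d≡ℓ+1 (sym (next-below (s≤s (n≤1+n ℓ))))))
    where d≡ℓ+1 = ≤-antisym (≤-pred (≤∧≢⇒< (≤-pred d<m) d≢top)) ℓ<d

  record Symmetry : Set where
    field
      apply unapply     : ℕ → ℕ
      apply-<           : ∀ {p} → p < m → apply p < m
      unapply-<         : ∀ {p} → p < m → unapply p < m
      apply-unapply     : ∀ {p} → p < m → apply (unapply p) ≡ p
      cycleAdj-apply    : ∀ {p q} → p < m → q < m → cycleAdj (apply p) (apply q) ≡ cycleAdj p q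
  open Symmetry public

  identity : Symmetry
  identity = record { apply = λ p → p ; unapply = λ p → p ; apply-< = λ p<m → p<m ; unapply-< = λ p<m → p<m
                    ; apply-unapply = λ _ → refl ; cycleAdj-apply = λ _ _ → refl }

  infixr 9 _∘ˢ_
  _∘ˢ_ : Symmetry → Symmetry → Symmetry
  σ ∘ˢ τ = record
    { apply          = apply σ ∘ apply τ
    ; unapply        = unapply τ ∘ unapply σ
    ; apply-<        = apply-< σ ∘ apply-< τ
    ; unapply-<      = unapply-< τ ∘ unapply-< σ
    ; apply-unapply  = λ p<m → trans (cong (apply σ) (apply-unapply τ (unapply-< σ p<m)))
                                     (apply-unapply σ p<m)
    ; cycleAdj-apply = λ p<m q<m → trans (cycleAdj-apply σ (apply-< τ p<m) (apply-< τ q<m))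
                                         (cycleAdj-apply τ p<m q<m)
    }

  rotation : Symmetry
  rotation = record { apply = prev ; unapply = next ; apply-< = prev-< ; unapply-< = next-<
                    ; apply-unapply = prev-next ; cycleAdj-apply = cycleAdj-prev }

  reflection : Symmetry
  reflection = record { apply = reflect ; unapply = reflect ; apply-< = reflect-< ; unapply-< = reflect-<
                      ; apply-unapply = reflect-involutive ; cycleAdj-apply = cycleAdj-reflect }

  rotate : ℕ → Symmetry
  rotate zero    = identity
  rotate (suc k) = rotation ∘ˢ rotate k

  rotate-self : ∀ k → apply (rotate k) k ≡ 0
  rotate-self k = trans (cong (apply (rotate k)) (sym (+-identityʳ k))) (rotate-+ k 0)
    where
    rotate-+ : ∀ k j → apply (rotate k) (k + j) ≡ j
    rotate-+ zero    j = refl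
    rotate-+ (suc k) j = cong prev (trans (cong (apply (rotate k)) (sym (+-suc k j))) (rotate-+ k (suc j)))

  normalising : ∀ {p q} → p < m → q < m → cycleAdj p q ≡ true
              → Σ Symmetry λ σ → apply σ p ≡ 0 × apply σ q ≡ 1
  normalising {p} {q} p<m q<m p~q with cycleAdj⇒next {0} {apply (rotate p) q}
    (trans (cong (λ x → cycleAdj x (apply (rotate p) q)) (sym (rotate-self p)))
           (trans (cycleAdj-apply (rotate p) p<m q<m) p~q))
  ... | inj₁ e = rotate p , rotate-self p , trans e (next-below z<s)
  ... | inj₂ e = reflection ∘ˢ rotate p , cong reflect (rotate-self p) ,
                 trans (cong reflect (next≡0⇒ (sym e))) reflect-top

-- The cycle C_{ℓ+3} with every vertex doubled into two non-adjacent twins: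
-- vertices are Fin (m + m), the two halves being the two layers.
module DoubledCycle (ℓ : ℕ) where
  open Cycle ℓ

  position : Fin (m + m) → ℕ
  position v = [ toℕ , toℕ ]′ (splitAt m v)

  position-< : ∀ v → position v < m
  position-< v with splitAt m v
  ... | inj₁ x = toℕ<n x
  ... | inj₂ x = toℕ<n x

  doubledCycle : Graph
  doubledCycle = record
    { n         = m + m
    ; adj       = λ u w → cycleAdj (position u) (position w)
    ; adj-sym   = λ u w → Bool.∨-comm (next (position u) ≡ᵇ position w) (next (position w) ≡ᵇ position u)
    ; adj-irref = λ u → cycleAdj-irrefl (position u)
    }

  vertexAt : Bool → ∀ p → p < m → Fin (m + m)
  vertexAt false p p<m = join m m (inj₁ (fromℕ< p<m))
  vertexAt true  p p<m = join m m (inj₂ (fromℕ< p<m))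

  position-vertexAt : ∀ b {p} (p<m : p < m) → position (vertexAt b p p<m) ≡ p
  position-vertexAt false p<m rewrite splitAt-join m m (inj₁ (fromℕ< p<m)) = toℕ-fromℕ< p<m
  position-vertexAt true  p<m rewrite splitAt-join m m (inj₂ (fromℕ< p<m)) = toℕ-fromℕ< p<m

  vertexAt-layers : ∀ {p q} (p<m : p < m) (q<m : q < m) → vertexAt false p p<m ≢ vertexAt true q q<m
  vertexAt-layers p<m q<m e with trans (sym (splitAt-join m m (inj₁ (fromℕ< p<m))))
                                  (trans (cong (splitAt m) e) (splitAt-join m m (inj₂ (fromℕ< q<m))))
  ... | ()

  twin : Fin (m + m) → Fin (m + m)
  twin v = join m m (swap (splitAt m v))

  position-twin : ∀ v → position (twin v) ≡ position v
  position-twin v with splitAt m v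
  ... | inj₁ x rewrite splitAt-join m m (inj₂ x) = refl
  ... | inj₂ x rewrite splitAt-join m m (inj₁ x) = refl

  twin≢ : ∀ v → twin v ≢ v
  twin≢ v e = swap≢ (trans (sym (splitAt-join m m (swap (splitAt m v)))) (cong (splitAt m) e))
    where
    swap≢ : ∀ {x : Fin m ⊎ Fin m} → swap x ≢ x
    swap≢ {inj₁ _} ()
    swap≢ {inj₂ _} ()

  module NormalisedCopy (1≤ℓ : 1 ≤ ℓ) (ℓ≢2 : ℓ ≢ 2) (f : Embedding (Path ℓ) doubledCycle) where
    open PathCopy f

    normalisation : Σ Symmetry λ σ → apply σ (position (vertex 0)) ≡ 0 × apply σ (position (vertex 1)) ≡ 1
    normalisation = normalising (position-< (vertex 0)) (position-< (vertex 1)) (vertex-step 1≤ℓ)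

    σ : Symmetry
    σ = proj₁ normalisation

    coordinate : Fin (m + m) → ℕ
    coordinate w = apply σ (position w)

    coordinate-< : ∀ w → coordinate w < m
    coordinate-< w = apply-< σ (position-< w)

    adj≡cycleAdj : ∀ u w → adj doubledCycle u w ≡ cycleAdj (coordinate u) (coordinate w)
    adj≡cycleAdj u w = sym (cycleAdj-apply σ (position-< u) (position-< w))

    -- Induction along the path: v_{k+2} cannot step back to the coordinate of v_k,
    -- as it would then be a twin of v_k.
    coordinate-vertex-pair : ∀ {k} → suc k ≤ ℓ → coordinate (vertex k) ≡ k × coordinate (vertex (suc k)) ≡ suc k
    coordinate-vertex-pair {zero}  _        = proj₂ normalisation
    coordinate-vertex-pair {suc k} k+2≤ℓ = c[k+1] , c[k+2]
      where
      c[k]   = proj₁ (coordinate-vertex-pair (≤-trans (n≤1+n _) k+2≤ℓ))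
      c[k+1] = proj₂ (coordinate-vertex-pair (≤-trans (n≤1+n _) k+2≤ℓ))
      step : cycleAdj (suc k) (coordinate (vertex (2 + k))) ≡ true
      step = subst (λ c → cycleAdj c (coordinate (vertex (2 + k))) ≡ true) c[k+1]
                   (trans (sym (adj≡cycleAdj (vertex (suc k)) (vertex (2 + k)))) (vertex-step k+2≤ℓ))
      c[k+2] : coordinate (vertex (2 + k)) ≡ 2 + k
      c[k+2] with cycleAdj⇒next step
      ... | inj₁ c≡next = trans c≡next (next-below (≤-trans k+2≤ℓ (m≤n+m ℓ 2)))
      ... | inj₂ next≡c = contradiction twins (not-twins k+2≤ℓ ℓ≢2)
        where
        same : coordinate (vertex (2 + k)) ≡ coordinate (vertex k)
        same = trans (next≡suc⇒ (sym next≡c)) (sym c[k])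
        twins : ∀ w → adj doubledCycle (vertex (2 + k)) w ≡ adj doubledCycle (vertex k) w
        twins w = trans (adj≡cycleAdj (vertex (2 + k)) w)
                    (trans (cong (λ c → cycleAdj c (coordinate w)) same) (sym (adj≡cycleAdj (vertex k) w)))

    coordinate-vertex : ∀ {k} → k ≤ ℓ → coordinate (vertex k) ≡ k
    coordinate-vertex {zero}  _     = proj₁ (proj₂ normalisation)
    coordinate-vertex {suc k} k+1≤ℓ = proj₂ (coordinate-vertex-pair k+1≤ℓ)

    coordinate-map : ∀ i → coordinate (map f i) ≡ toℕ i
    coordinate-map i = trans (cong coordinate (map≡vertex i)) (coordinate-vertex (≤-pred (toℕ<n i)))

    dominating : ∀ w → InClosedNbhd f w
    dominating w with cycle-dominated 1≤ℓ (coordinate-< w)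
    ... | j , j≤ℓ , w~j = index j , inj₂ (trans (adj≡cycleAdj w (vertex j))
                                              (trans (cong (cycleAdj (coordinate w)) (coordinate-vertex j≤ℓ)) w~j))

    ∉copy : ∀ {w} → ℓ < coordinate w → ∀ i → w ≢ map f i
    ∉copy ℓ<c i refl = <-irrefl (sym (coordinate-map i)) (≤-<-trans (≤-pred (toℕ<n i)) ℓ<c)

    adj-map : ∀ w i → adj doubledCycle w (map f i) ≡ cycleAdj (coordinate w) (toℕ i)
    adj-map w i = trans (adj≡cycleAdj w (map f i)) (cong (cycleAdj (coordinate w)) (coordinate-map i))

    pendant-top : ∀ {w} → coordinate w ≡ top → Pendant doubledCycle (map f) zeroF w
    pendant-top {w} c≡top =
      trans (adj-map w zeroF) (trans (cong (λ c → cycleAdj c 0) c≡top) cycleAdj-top-0) ,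
      ∉copy (subst (ℓ <_) (sym c≡top) (n≤1+n (suc ℓ))) ,
      λ j w~j → toℕ-injective (cycleAdj-top⇒0 (≤-pred (toℕ<n j))
        (trans (cong (λ c → cycleAdj c (toℕ j)) (sym c≡top)) (trans (sym (adj-map w j)) w~j)))

    coordinate-twin-last : coordinate (twin (vertex ℓ)) ≡ ℓ
    coordinate-twin-last = trans (cong (apply σ) (position-twin (vertex ℓ))) (coordinate-vertex ≤-refl)

    pendant-twin-last : ∀ {t} → toℕ t ≡ ℓ ∸ 1 → Pendant doubledCycle (map f) t (twin (vertex ℓ))
    pendant-twin-last {t} t≡ℓ-1 =
      trans (adj-map w t) (trans (cong₂ cycleAdj coordinate-twin-last t≡ℓ-1) (cycleAdj-last 1≤ℓ)) ,
      (λ i w≡i → twin≢ (vertex ℓ) (trans w≡i (trans (map≡vertex i) (cong vertex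
        (trans (sym (coordinate-map i)) (trans (cong coordinate (sym w≡i)) coordinate-twin-last)))))) ,
      λ j w~j → toℕ-injective (trans (cycleAdj-last⇒ (≤-pred (toℕ<n j))
        (trans (cong (λ c → cycleAdj c (toℕ j)) (sym coordinate-twin-last)) (trans (sym (adj-map w j)) w~j)))
        (sym t≡ℓ-1))
      where w = twin (vertex ℓ)

    apex : Bool → Fin (m + m)
    apex b = vertexAt b (unapply σ top) (unapply-< σ ≤-refl)

    coordinate-apex : ∀ b → coordinate (apex b) ≡ top
    coordinate-apex b = trans (cong (apply σ) (position-vertexAt b _)) (apply-unapply σ ≤-refl)

    unclosable-apexes : UnclosableExtension f zeroF zeroF
    unclosable-apexes =
      pendants⇒extension f (pendant-top (coordinate-apex false)) (pendant-top (coordinate-apex true))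
                           apart apexes≁ ,
      dominating⇒¬closingPath f dominating apart apexes≁
      where
      apart = vertexAt-layers (unapply-< σ ≤-refl) (unapply-< σ ≤-refl)
      apexes≁ : ¬ Adj doubledCycle (apex false) (apex true)
      apexes≁ a = true≢false (trans (sym a) (trans (adj≡cycleAdj (apex false) (apex true))
        (trans (cong₂ cycleAdj (coordinate-apex false) (coordinate-apex true)) (cycleAdj-irrefl top))))

    unclosable-apex-twin : ∀ {t} → toℕ t ≡ ℓ ∸ 1 → UnclosableExtension f zeroF t
    unclosable-apex-twin t≡ℓ-1 =
      pendants⇒extension f (pendant-top (coordinate-apex false)) (pendant-twin-last t≡ℓ-1) apart apex≁twin ,
      dominating⇒¬closingPath f dominating apart apex≁twin
      where
      apart : apex false ≢ twin (vertex ℓ)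
      apart e = <-irrefl (trans (sym coordinate-twin-last) (trans (cong coordinate (sym e)) (coordinate-apex false)))
                         (n≤1+n (suc ℓ))
      apex≁twin : ¬ Adj doubledCycle (apex false) (twin (vertex ℓ))
      apex≁twin a = <-irrefl (sym (cycleAdj-top⇒0 ≤-refl
        (trans (sym (cong₂ cycleAdj (coordinate-apex false) coordinate-twin-last))
               (trans (sym (adj≡cycleAdj (apex false) (twin (vertex ℓ)))) a)))) 1≤ℓ

  copyAlongCycle : Embedding (Path ℓ) doubledCycle
  copyAlongCycle = record
    { map     = λ i → vertexAt false (toℕ i) (i<m i)
    ; inj     = λ {i} {j} e → toℕ-injective (trans (sym (position-vertexAt false (i<m i)))
                                (trans (cong position e) (position-vertexAt false (i<m j))))
    ; induced = induced′
    }
    where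
    i<top : ∀ (i : Fin (suc ℓ)) → toℕ i < top
    i<top i = ≤-trans (toℕ<n i) (n≤1+n _)
    i<m : ∀ (i : Fin (suc ℓ)) → toℕ i < m
    i<m i = <-trans (i<top i) (n<1+n top)
    induced′ : ∀ i j → cycleAdj (position (vertexAt false (toℕ i) (i<m i)))
                                (position (vertexAt false (toℕ j) (i<m j))) ≡ pathAdj ℓ i j
    induced′ i j rewrite position-vertexAt false (i<m i) | position-vertexAt false (i<m j)
                       | next-below (i<top i) | next-below (i<top j) = refl

  first-family : 1 ≤ ℓ → ℓ ≢ 2 → ¬ Inherent (Path ℓ) zeroF zeroF
  first-family 1≤ℓ ℓ≢2 = unclosable⇒¬inherent copyAlongCycle (NormalisedCopy.unclosable-apexes 1≤ℓ ℓ≢2)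

  second-family : 3 ≤ ℓ → ∀ t → toℕ t ≡ ℓ ∸ 1 → ¬ Inherent (Path ℓ) zeroF t
  second-family 3≤ℓ t t≡ℓ-1 = unclosable⇒¬inherent copyAlongCycle λ f →
    NormalisedCopy.unclosable-apex-twin (≤-trans (s≤s z≤n) 3≤ℓ) (λ { refl → <-irrefl refl 3≤ℓ }) f t≡ℓ-1

open Search using (allCopiesTrapped⇒¬inherent)

theorem1p7 : ∀ (ℓ : ℕ) (t : Fin (suc ℓ)) → Condition ℓ t → ¬ Inherent (Path ℓ) zeroF t
theorem1p7 ℓ t (inj₁ (1≤ℓ , t≡0)) with toℕ-injective {i = t} {j = zeroF} t≡0 | ℓ ℕ.≟ 2
... | refl | no ℓ≢2  = DoubledCycle.first-family ℓ 1≤ℓ ℓ≢2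
... | refl | yes refl = allCopiesTrapped⇒¬inherent petersen (embedding (lookup (# 0 ∷ # 1 ∷ # 2 ∷ [])) _) _
theorem1p7 ℓ t (inj₂ (inj₁ (3≤ℓ , t≡ℓ-1))) = DoubledCycle.second-family ℓ 3≤ℓ t t≡ℓ-1
theorem1p7 .3 t (inj₂ (inj₂ (inj₁ (refl , t≡1)))) with toℕ-injective {j = # 1} t≡1
... | refl = allCopiesTrapped⇒¬inherent petersen (embedding (lookup (# 0 ∷ # 1 ∷ # 2 ∷ # 3 ∷ [])) _) _
theorem1p7 .4 t (inj₂ (inj₂ (inj₂ (inj₁ (refl , t≡1))))) with toℕ-injective {j = # 1} t≡1
... | refl = allCopiesTrapped⇒¬inherent heawood (embedding (lookup (# 0 ∷ # 7 ∷ # 4 ∷ # 11 ∷ # 1 ∷ [])) _) _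
theorem1p7 .5 t (inj₂ (inj₂ (inj₂ (inj₂ (refl , t≡2))))) with toℕ-injective {j = # 2} t≡2
... | refl = allCopiesTrapped⇒¬inherent heawood (embedding (lookup (# 0 ∷ # 7 ∷ # 4 ∷ # 11 ∷ # 1 ∷ # 9 ∷ [])) _) _
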